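{- Let $\mathcal{S}=\{S_1,\dots,S_N\}\subseteq 2^{[n]}$ be a Sperner family and $h:\mathcal{S}\to 2^{[n]}$ a function with $H_i=h(S_i)\subseteq S_i$ for every $i\in[N]$. Let $G_{\mathcal{S},h}$ be the graph with vertex set $\{(S_i,H_i): i\in[N]\}$ in which $(S_i,H_i)$ and $(S_j,H_j)$ ($i\ne j$) are adjacent if and only if $S_i\cap H_j=S_j\cap H_i$. If $G_{\mathcal{S},h}$ has a vertex of degree at most $1$, then there exists $S_0\in\mathcal{S}$ such that $\mathcal{Q}_{S_0,h(S_0)}\not\subseteq\bigcup_{S\in\mathcal{S}\setminus\{S_0\}}\mathcal{Q}_{S,h(S)}$.
   Context: $[n]=\{1,\dots,n\}$. A Sperner family is a family of sets none of whose members contains another. For $H\subseteq S\subseteq[n]$ let $\mathcal{Q}_{S,H}=\{H\cup B: B\subseteq[n]\setminus S\}$, i.e. the family of subsets $F\subseteq[n]$ with $F\cap S=H$. -}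

module Defs where

open import Data.Nat using (ℕ)
open import Data.Bool using (Bool)
open import Data.Bool.Properties using () renaming (_≟_ to _≟ᵇ_)
open import Data.Fin using (Fin; _≟_)
open import Data.Fin.Subset using (Subset; _∩_; _⊆_)
open import Data.Vec.Properties using (≡-dec)
open import Data.List using (List; length; filter)
open import Data.List using () renaming (allFin to allFinL)
open import Data.Product using (_×_; _,_)
open import Relation.Nullary using (¬_; Dec; yes; no)
open import Relation.Nullary.Decidable using (_×-dec_; ¬?)
open import Relation.Binary.PropositionalEquality using (_≡_)

_≟ˢ_ : ∀ {n} → (A B : Subset n) → Dec (A ≡ B)
_≟ˢ_ = ≡-dec _≟ᵇ_

IsSperner : ∀ {n N} → (Fin N → Subset n) → Set
IsSperner {N = N} S = ∀ (i j : Fin N) → ¬ (i ≡ j) → ¬ (S i ⊆ S j)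

_∈Q[_,_] : ∀ {n} → Subset n → Subset n → Subset n → Set
F ∈Q[ S , H ] = F ∩ S ≡ H

Adj : ∀ {n N} → (Fin N → Subset n) → (Fin N → Subset n) → Fin N → Fin N → Set
Adj S H i j = ¬ (i ≡ j) × (S i ∩ H j ≡ S j ∩ H i)

adj? : ∀ {n N} (S H : Fin N → Subset n) (i j : Fin N) → Dec (Adj S H i j)
adj? S H i j = ¬? (i ≟ j) ×-dec ((S i ∩ H j) ≟ˢ (S j ∩ H i))

degree : ∀ {n N} → (Fin N → Subset n) → (Fin N → Subset n) → Fin N → ℕ
degree {N = N} S H i = length (filter (adj? S H i) (allFinL N))

module Submission where

-- Write Q_i for Q_{S_i,H_i}.  Two elementary facts drive the
-- argument:
--   (1) if some F lies in Q_i and in Q_j (i ≠ j), then S_i ∩ H_j = F ∩ S_i ∩ S_j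
--       = S_j ∩ H_i, i.e. i and j are adjacent in G_{S,h};
--   (2) if H ⊆ S and S' ⊈ S, then Q_{S,H} ⊈ Q_{S',H'} for every H': pick
--       x ∈ S' \ S and put x into F or leave it out, whichever disagrees with H'.
-- By (1), a member of Q_v that avoids Q_j for every neighbour j of v avoids
-- Q_j for every j ≠ v.  Let v have degree at most 1.  If v has no neighbour,
-- F = H_v ∈ Q_v works.  Otherwise v has exactly one neighbour u; since the
-- family is Sperner, S_u ⊈ S_v, and (2) gives F ∈ Q_v \ Q_u.

open import Defs
open import Data.Nat using (ℕ; _≤_; s≤s)
open import Data.Fin using (Fin)
open import Data.Fin.Properties using (any?; ¬∀⟶∃¬)
open import Data.Fin.Subset using (Subset; _⊆_; _∩_; _∪_; _∈_; _∉_; ⁅_⁆)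
open import Data.Fin.Subset.Properties
  using (_∈?_; ∩-comm; ∩-assoc; ⊆-antisym; x∈p∩q⁺; x∈p∩q⁻; x∈p∪q⁻; p⊆p∪q; q⊆p∪q; x∈⁅x⁆; x∈⁅y⁆⇒x≡y)
open import Data.Product using (∃; _×_; _,_; proj₁)
open import Data.Sum using (inj₁; inj₂)
open import Data.List using (List; []; _∷_; length; filter)
open import Data.List using () renaming (allFin to allFinL)
open import Data.List.Membership.Propositional using () renaming (_∈_ to _∈ₗ_)
open import Data.List.Membership.Propositional.Properties using (∈-filter⁺; ∈-allFin)
open import Data.List.Relation.Unary.Any using (here)
open import Relation.Nullary using (¬_; yes; no; contradiction)
open import Relation.Nullary.Decidable using (decidable-stable; _→-dec_)
open import Relation.Binary.PropositionalEquality using (_≡_; sym; trans; cong; subst; module ≡-Reasoning)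

module _ {n : ℕ} where

  agree⇒∈Q : ∀ {F S H : Subset n} → H ⊆ S →
    (∀ {x} → x ∈ S → x ∈ F → x ∈ H) → (∀ {x} → x ∈ H → x ∈ F) → F ∈Q[ S , H ]
  agree⇒∈Q {F} {S} {H} H⊆S F⊆H H⊆F = ⊆-antisym
    (λ x∈F∩S → let (x∈F , x∈S) = x∈p∩q⁻ F S x∈F∩S in F⊆H x∈S x∈F)
    (λ x∈H → x∈p∩q⁺ (H⊆F x∈H , H⊆S x∈H))

  centre∈Q : ∀ {S H : Subset n} → H ⊆ S → H ∈Q[ S , H ]
  centre∈Q H⊆S = agree⇒∈Q H⊆S (λ _ x∈H → x∈H) (λ x∈H → x∈H)

  common-member⇒cross-equal : ∀ {F S H S' H' : Subset n} →
    F ∈Q[ S , H ] → F ∈Q[ S' , H' ] → S ∩ H' ≡ S' ∩ H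
  common-member⇒cross-equal {F} {S} {H} {S'} {H'} F∈Q F∈Q' = begin
    S ∩ H'         ≡⟨ cong (S ∩_) (sym F∈Q') ⟩
    S ∩ (F ∩ S')   ≡⟨ sym (∩-assoc S F S') ⟩
    (S ∩ F) ∩ S'   ≡⟨ cong (_∩ S') (∩-comm S F) ⟩
    (F ∩ S) ∩ S'   ≡⟨ cong (_∩ S') F∈Q ⟩
    H ∩ S'         ≡⟨ ∩-comm H S' ⟩
    S' ∩ H         ∎
    where open ≡-Reasoning

  -- Fact (2): a point x ∈ S' \ S lets us leave Q_{S',H'} while staying in Q_{S,H}.
  -- If x ∈ H' take F = H (so x ∉ F), otherwise F = H ∪ {x}.
  escape : ∀ {S H S' H' : Subset n} {x : Fin n} → H ⊆ S → x ∈ S' → x ∉ S →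
    ∃ λ F → F ∈Q[ S , H ] × ¬ (F ∈Q[ S' , H' ])
  escape {S} {H} {S'} {H'} {x} H⊆S x∈S' x∉S with x ∈? H'
  ... | yes x∈H' = H , centre∈Q H⊆S , λ H∈Q' →
    x∉S (H⊆S (proj₁ (x∈p∩q⁻ H S' (subst (x ∈_) (sym H∈Q') x∈H'))))
  ... | no x∉H' = H ∪ ⁅ x ⁆ , F∈Q , λ F∈Q' →
    x∉H' (subst (x ∈_) F∈Q' (x∈p∩q⁺ (q⊆p∪q H ⁅ x ⁆ (x∈⁅x⁆ x) , x∈S')))
    where
    -- adding x ∉ S does not change the trace on S
    F∈Q : (H ∪ ⁅ x ⁆) ∈Q[ S , H ]
    F∈Q = agree⇒∈Q H⊆S added⇒old (p⊆p∪q ⁅ x ⁆)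
      where
      added⇒old : ∀ {y} → y ∈ S → y ∈ H ∪ ⁅ x ⁆ → y ∈ H
      added⇒old y∈S y∈F with x∈p∪q⁻ H ⁅ x ⁆ y∈F
      ... | inj₁ y∈H = y∈H
      ... | inj₂ y∈⁅x⁆ = contradiction (subst (_∈ S) (x∈⁅y⁆⇒x≡y x y∈⁅x⁆) y∈S) x∉S

  ⊈⇒∃∉ : ∀ {A B : Subset n} → ¬ (A ⊆ B) → ∃ λ x → x ∈ A × x ∉ B
  ⊈⇒∃∉ {A} {B} A⊈B with ¬∀⟶∃¬ n (λ x → x ∈ A → x ∈ B) (λ x → x ∈? A →-dec x ∈? B) (λ f → A⊈B (f _))
  ... | x , x∈A↛x∈B =
    x , decidable-stable (x ∈? A) (λ x∉A → x∈A↛x∈B (λ x∈A → contradiction x∈A x∉A)) , λ x∈B → x∈A↛x∈B (λ _ → x∈B)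

length≤1⇒unique : ∀ {A : Set} {xs : List A} {a b : A} → length xs ≤ 1 → a ∈ₗ xs → b ∈ₗ xs → a ≡ b
length≤1⇒unique {xs = _ ∷ []} _ (here a≡c) (here b≡c) = trans a≡c (sym b≡c)
length≤1⇒unique {xs = _ ∷ _ ∷ _} (s≤s ())

module Graph {n N : ℕ} (S H : Fin N → Subset n) where

  degree≤1⇒unique-neighbour : ∀ {v j k} → degree S H v ≤ 1 → Adj S H v j → Adj S H v k → j ≡ k
  degree≤1⇒unique-neighbour {v} deg adj-j adj-k =
    length≤1⇒unique deg (listed adj-j) (listed adj-k)
    where
    listed : ∀ {i} → Adj S H v i → i ∈ₗ filter (adj? S H v) (allFinL N)
    listed {i} adj-i = ∈-filter⁺ (adj? S H v) (∈-allFin i) adj-i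

  avoid-neighbours⇒avoid-all : ∀ {v} {F : Subset n} → F ∈Q[ S v , H v ] →
    (∀ j → Adj S H v j → ¬ (F ∈Q[ S j , H j ])) →
    ∀ j → ¬ (j ≡ v) → ¬ (F ∈Q[ S j , H j ])
  avoid-neighbours⇒avoid-all F∈Qv avoid j j≢v F∈Qj =
    avoid j ((λ v≡j → j≢v (sym v≡j)) , common-member⇒cross-equal F∈Qv F∈Qj) F∈Qj

open Graph

claim19 : (n N : ℕ) (S H : Fin N → Subset n) →
    IsSperner S →
    (∀ i → H i ⊆ S i) →
    (∃ λ (v : Fin N) → degree S H v ≤ 1) →
    ∃ λ (i₀ : Fin N) → ∃ λ (F : Subset n) →
    F ∈Q[ S i₀ , H i₀ ] × (∀ (j : Fin N) → ¬ (j ≡ i₀) → ¬ (F ∈Q[ S j , H j ]))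
claim19 n N S H sperner H⊆S (v , deg) with any? (adj? S H v)
... | no isolated = v , H v , centre∈Q (H⊆S v) ,
  avoid-neighbours⇒avoid-all S H (centre∈Q (H⊆S v)) (λ j adj _ → isolated (j , adj))
... | yes (u , adj-u) with ⊈⇒∃∉ (sperner u v (λ u≡v → proj₁ adj-u (sym u≡v)))
... | x , x∈Su , x∉Sv with escape {H' = H u} (H⊆S v) x∈Su x∉Sv
... | F , F∈Qv , F∉Qu = v , F , F∈Qv ,
  avoid-neighbours⇒avoid-all S H F∈Qv
    (λ j adj-j → subst (λ k → ¬ (F ∈Q[ S k , H k ])) (degree≤1⇒unique-neighbour S H deg adj-u adj-j) F∉Qu)
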